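{- Let $g\in\mathbb N^+$, let $\mathit{Eng}_g$ be the engine CPS defined in the context, and let $\mathit{Eng}_g\xrightarrow{\alpha_1}\cdots\xrightarrow{\alpha_n}M$ be an arbitrary computation trace. If $M$ turns the cooling on (i.e. $M$ performs a transition arising from writing $\mathsf{on}$ on the actuator $\mathit{cool}$), then the value of the state variable $\mathit{temp}$ in $M$ lies in $(9.9,11.5]$; if $M$ turns the cooling off (writes $\mathsf{off}$ on $\mathit{cool}$), then the value of $\mathit{temp}$ in $M$ lies in $(2.9,8.5]$.
   Context: The calculus. Physical state $S=\langle\xi_x,\xi_s,\xi_a\rangle$ (functions from state variables, sensors, actuators to reals); environment $E=\langle\mathit{evol},\mathit{meas},\mathit{inv}\rangle$ with $\mathit{evol}$ mapping (state function, actuator function) to a finite-support distribution over state functions, $\mathit{meas}$ mapping a state function to a finite-support distribution over sensor functions, $\mathit{inv}$ a set of state functions; $\mathit{next}_E(S)=\sum_{\xi'_x,\xi'_s}\mathit{evol}(\xi_x,\xi_a)(\xi'_x)\mathit{meas}(\xi'_x)(\xi'_s)\overline{\langle\xi'_x,\xi'_s,\xi_a\rangle}$ ($\overline{o}$ = Dirac). Processes: $P::=\mathsf{nil}\mid \mathsf{tick}.C\mid P\parallel Q\mid \lfloor \mathit{chn}.C\rfloor D\mid \mathit{phy}.C\mid \mathsf{if}\ b\ \mathsf{then}\ P\ \mathsf{else}\ Q\mid P\backslash c\mid X\mid \mathsf{fix}\,X.P$, $C::=\bigoplus_ip_i{:}P_i$, $\mathit{chn}::=c!v\mid c?(x)$,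 $\mathit{phy}::=\mathsf{read}\ s(x)\mid\mathsf{write}\ a\langle v\rangle$; time-guarded recursion; conditional identified with selected branch; $[\![\bigoplus_ip_i{:}P_i]\!]=\sum_ip_i\overline{P_i}$. Process transitions: $\lfloor c!v.C\rfloor D\xrightarrow{c!v}[\![C]\!]$; $\lfloor c?(x).C\rfloor D\xrightarrow{c?v}[\![C]\!]\{v/x\}$; $\mathsf{write}\ a\langle v\rangle.C\xrightarrow{a!v}[\![C]\!]$; $\mathsf{read}\ s(x).C\xrightarrow{s?x}[\![C]\!]$; $c!v$/$c?v$ synchronise to $\tau$ under $\parallel$; non-tick moves propagate through $\parallel$; moves other than $c!v,c?v$ through $\backslash c$; recursion unfolds; $\mathsf{nil}\xrightarrow{\mathsf{tick}}\overline{\mathsf{nil}}$; $\mathsf{tick}.C\xrightarrow{\mathsf{tick}}[\![C]\!]$; $\lfloor\mathit{chn}.C\rfloor D\xrightarrow{\mathsf{tick}}[\![D]\!]$; $P_1\parallel P_2\xrightarrow{\mathsf{tick}}\pi_1\parallel\pi_2$ if both tick and no $\tau$-move. CPS $E;S\rhd P$ rules: $P\xrightarrow{\alpha}\pi$, $\alpha\in\{c!v,c?v,\tau\}$, $S\in\mathit{inv}$ give $E;S\rhd P\xrightarrow{\alpha}E;\overline S\rhd\pi$; $P\xrightarrow{s?z}\pi$, $S\in\mathit{inv}$ give $\xrightarrow{\tau}E;\overline S\rhd\pi\{\xi_s(s)/z\}$; $P\xrightarrow{a!v}\pi$, $S\in\mathit{inv}$ give $\xrightarrow{\tau}E;\overline{\langle\xi_x,\xi_s,\xi_a[a\mapsto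 v]\rangle}\rhd\pi$; $P\xrightarrow{\mathsf{tick}}\pi$, no $\tau$-move, $S\in\mathit{inv}$ give $\xrightarrow{\mathsf{tick}}E;\mathit{next}_E(S)\rhd\pi$; $S\notin\mathit{inv}$ gives $\xrightarrow{\tau}\overline{\mathsf{Dead}}$. A computation trace $M_1\xrightarrow{\alpha_1}\cdots\xrightarrow{\alpha_{n}}M_{n+1}$ means $M_i\xrightarrow{\alpha_i}\gamma_{i+1}$ with $M_{i+1}\in\mathrm{supp}(\gamma_{i+1})$. The engine. $[v,w]_g=\{k\in[v,w]:k=v+h\cdot10^{ -g},h\in\mathbb N\}$; $\delta=0.4$, $\mathit{err}=0.1$. State variable $\mathit{temp}$, sensor $s_t$, actuator $\mathit{cool}\in\{\mathsf{on},\mathsf{off}\}$. $S_g$: $\mathit{temp}=0$, $s_t=0$, $\mathit{cool}=\mathsf{off}$. $\mathit{Env}_g$: $\mathit{evol}(\xi_x,\xi_a)$ is uniform over $[\mathit{temp}\mapsto\xi_x(\mathit{temp})+v]$, $v\in[v_1,v_2]_g$, with $[v_1,v_2]=[1-\delta,1+\delta]$ if cooling is $\mathsf{off}$ and $[-1-\delta,-1+\delta]$ if $\mathsf{on}$; $\mathit{meas}(\xi_x)$ is uniform over $[s_t\mapsto\xi_x(\mathit{temp})+v]$, $v\in[-\mathit{err},\mathit{err}]_g$; $\mathit{inv}=\{[\mathit{temp}\mapsto x]:0\le x\le30\}$. $\mathsf{tick}^k.P$ is $k$ nested ticks; $c!v.P$ abbreviates $\mathsf{fix}\,Z.\lfloor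 c!v.P\rfloor Z$. $\mathit{Ctrl}=\mathsf{fix}\,X.\mathsf{read}\ s_t(x).\mathsf{if}\ x>10\ \mathsf{then}\ \mathit{Cooling}\ \mathsf{else}\ \mathsf{tick}.X$, $\mathit{Cooling}=\mathsf{write}\ \mathit{cool}\langle\mathsf{on}\rangle.\mathsf{fix}\,Y.\mathsf{tick}^5.\mathsf{read}\ s_t(x).\mathsf{if}\ x>10\ \mathsf{then}\ \mathit{warning}!\mathrm{ID}.Y\ \mathsf{else}\ \mathsf{write}\ \mathit{cool}\langle\mathsf{off}\rangle.\mathsf{tick}.X$. $\mathit{Eng}_g=\mathit{Env}_g;S_g\rhd\mathit{Ctrl}$.
   Formalization: The values of state variables, sensors and actuators, and all probabilities of the calculus, are taken in ℚ instead of the reals. -}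

module Defs where

open import Data.Nat as ℕ using (ℕ; zero; suc)
open import Data.Nat.Properties using (m^n≢0)
open import Data.Integer as ℤ using (ℤ; +_)
open import Data.Rational as ℚ using (ℚ; 0ℚ; 1ℚ; _+_; _*_; -_; _<_; _≤_; _/_)
open import Data.Rational.Properties using (_<?_; _≤?_)
open import Data.Fin using (Fin; zero; suc)
open import Data.List using (List; []; _∷_; map; concatMap; filter; upTo; length)
open import Data.List.Membership.Propositional using (_∈_)
open import Data.Product using (Σ; _×_; _,_)
open import Data.Bool using (Bool; true; false; if_then_else_)
open import Relation.Nullary using (¬_; Dec; yes; no; does)
open import Relation.Binary.PropositionalEquality using (_≡_)

-- Finite-support (sub)distributions, as lists of weighted outcomes.
-- Only supports matter for computation traces.

Dist : Set → Set
Dist A = List (ℚ × A)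

dirac : {A : Set} → A → Dist A
dirac a = (1ℚ , a) ∷ []

mapD : {A B : Set} → (A → B) → Dist A → Dist B
mapD f = map (λ { (p , a) → (p , f a) })

bindD : {A B : Set} → Dist A → (A → Dist B) → Dist B
bindD d f = concatMap (λ { (p , a) → map (λ { (q , b) → (p * q , b) }) (f a) }) d

supp : {A : Set} → Dist A → A → Set
supp d a = Σ ℚ λ p → ((p , a) ∈ d) × (0ℚ < p)

uniform : {A : Set} → List A → Dist A
uniform [] = []
uniform (x ∷ xs) = map (λ a → ((+ 1) / suc (length xs) , a)) (x ∷ xs)

data Val : Set where
  num : ℚ → Val
  on off : Val
  ID : Val

module Calculus (X Sn Ac Ch : Set)
                (_≟A_ : (a b : Ac) → Dec (a ≡ b))
                (_≟C_ : (a b : Ch) → Dec (a ≡ b)) where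

  record PState : Set where
    constructor ⟨_,_,_⟩
    field
      ξx : X → ℚ
      ξs : Sn → ℚ
      ξa : Ac → Val
  open PState public

  record Env : Set₁ where
    field
      evol : (X → ℚ) → (Ac → Val) → Dist (X → ℚ)
      meas : (X → ℚ) → Dist (Sn → ℚ)
      inv  : (X → ℚ) → Set
  open Env public

  next : Env → PState → Dist PState
  next E S = bindD (evol E (ξx S) (ξa S))
                   (λ x′ → mapD (λ s′ → ⟨ x′ , s′ , ξa S ⟩) (meas E x′))

  updA : (Ac → Val) → Ac → Val → (Ac → Val)
  updA f a v b with does (b ≟A a)
  ... | true  = v
  ... | false = f b

  -- Processes with n free process variables (de Bruijn); value binders
  -- (read / input) are higher-order; conditionals are Agda's if, i.e.
  -- identified with the selected branch.  A probabilistic choice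
  -- ⊕ᵢ pᵢ:Pᵢ is a list of weighted processes; its meaning [[C]] is the
  -- distribution Σᵢ pᵢ·(Pᵢ) (the list itself).
  data Proc (n : ℕ) : Set where
    nil     : Proc n
    tick    : List (ℚ × Proc n) → Proc n
    _∥_     : Proc n → Proc n → Proc n
    ⌊_!_∙_⌋_ : Ch → Val → List (ℚ × Proc n) → List (ℚ × Proc n) → Proc n
    ⌊_?∙_⌋_  : Ch → (Val → List (ℚ × Proc n)) → List (ℚ × Proc n) → Proc n
    read    : Sn → (Val → List (ℚ × Proc n)) → Proc n
    write   : Ac → Val → List (ℚ × Proc n) → Proc n
    _∖_     : Proc n → Ch → Proc n
    var     : Fin n → Proc n
    fix     : Proc (suc n) → Proc n

  Choice : ℕ → Set
  Choice n = List (ℚ × Proc n)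

  ext : {n m : ℕ} → (Fin n → Fin m) → Fin (suc n) → Fin (suc m)
  ext ρ zero = zero
  ext ρ (suc i) = suc (ρ i)

  mutual
    ren : {n m : ℕ} → (Fin n → Fin m) → Proc n → Proc m
    ren ρ nil = nil
    ren ρ (tick C) = tick (renC ρ C)
    ren ρ (P ∥ Q) = ren ρ P ∥ ren ρ Q
    ren ρ (⌊ c ! v ∙ C ⌋ D) = ⌊ c ! v ∙ renC ρ C ⌋ renC ρ D
    ren ρ (⌊ c ?∙ C ⌋ D) = ⌊ c ?∙ (λ v → renC ρ (C v)) ⌋ renC ρ D
    ren ρ (read s C) = read s (λ v → renC ρ (C v))
    ren ρ (write a v C) = write a v (renC ρ C)
    ren ρ (P ∖ c) = ren ρ P ∖ c
    ren ρ (var i) = var (ρ i)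
    ren ρ (fix P) = fix (ren (ext ρ) P)

    renC : {n m : ℕ} → (Fin n → Fin m) → Choice n → Choice m
    renC ρ [] = []
    renC ρ ((p , P) ∷ C) = (p , ren ρ P) ∷ renC ρ C

  exts : {n m : ℕ} → (Fin n → Proc m) → Fin (suc n) → Proc (suc m)
  exts σ zero = var zero
  exts σ (suc i) = ren suc (σ i)

  mutual
    sub : {n m : ℕ} → (Fin n → Proc m) → Proc n → Proc m
    sub σ nil = nil
    sub σ (tick C) = tick (subC σ C)
    sub σ (P ∥ Q) = sub σ P ∥ sub σ Q
    sub σ (⌊ c ! v ∙ C ⌋ D) = ⌊ c ! v ∙ subC σ C ⌋ subC σ D
    sub σ (⌊ c ?∙ C ⌋ D) = ⌊ c ?∙ (λ v → subC σ (C v)) ⌋ subC σ D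
    sub σ (read s C) = read s (λ v → subC σ (C v))
    sub σ (write a v C) = write a v (subC σ C)
    sub σ (P ∖ c) = sub σ P ∖ c
    sub σ (var i) = σ i
    sub σ (fix P) = fix (sub (exts σ) P)

    subC : {n m : ℕ} → (Fin n → Proc m) → Choice n → Choice m
    subC σ [] = []
    subC σ ((p , P) ∷ C) = (p , sub σ P) ∷ subC σ C

  unfold : Proc 1 → Proc 0
  unfold P = sub (λ { zero → fix P }) P

  wk : {n : ℕ} → Proc n → Proc (suc n)
  wk = ren suc

  par : Dist (Proc 0) → Dist (Proc 0) → Dist (Proc 0)
  par π₁ π₂ = bindD π₁ (λ P → mapD (λ Q → P ∥ Q) π₂)

  data Label : Set where
    _!_  : Ch → Val → Label
    _¿_  : Ch → Val → Label
    τ    : Label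
    wr   : Ac → Val → Label
    rd   : Sn → Val → Label      -- s?x, early style: the read value

  NotOn : Ch → Label → Set
  NotOn c (d ! v) = ¬ (d ≡ c)
  NotOn c (d ¿ v) = ¬ (d ≡ c)
  NotOn c _ = Data.Unit.⊤
    where import Data.Unit

  data _—[_]→_ : Proc 0 → Label → Dist (Proc 0) → Set where
    snd   : ∀ {c v C D} → (⌊ c ! v ∙ C ⌋ D) —[ c ! v ]→ C
    rcv   : ∀ {c C D} v → (⌊ c ?∙ C ⌋ D) —[ c ¿ v ]→ C v
    write′ : ∀ {a v C} → write a v C —[ wr a v ]→ C
    read′  : ∀ {s C} v → read s C —[ rd s v ]→ C v
    syncˡ : ∀ {P Q c v π₁ π₂} → P —[ c ! v ]→ π₁ → Q —[ c ¿ v ]→ π₂ →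
            (P ∥ Q) —[ τ ]→ par π₁ π₂
    syncʳ : ∀ {P Q c v π₁ π₂} → P —[ c ¿ v ]→ π₁ → Q —[ c ! v ]→ π₂ →
            (P ∥ Q) —[ τ ]→ par π₁ π₂
    parˡ  : ∀ {P Q α π} → P —[ α ]→ π → (P ∥ Q) —[ α ]→ mapD (λ P′ → P′ ∥ Q) π
    parʳ  : ∀ {P Q α π} → Q —[ α ]→ π → (P ∥ Q) —[ α ]→ mapD (λ Q′ → P ∥ Q′) π
    res   : ∀ {P c α π} → NotOn c α → P —[ α ]→ π → (P ∖ c) —[ α ]→ mapD (λ P′ → P′ ∖ c) π
    rec   : ∀ {P α π} → unfold P —[ α ]→ π → fix P —[ α ]→ π

  NoTau : Proc 0 → Set
  NoTau P = ¬ (Σ (Dist (Proc 0)) λ π → P —[ τ ]→ π)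

  data _—tick→_ : Proc 0 → Dist (Proc 0) → Set where
    nilT  : nil —tick→ dirac nil
    tickT : ∀ {C} → tick C —tick→ C
    sndT  : ∀ {c v C D} → (⌊ c ! v ∙ C ⌋ D) —tick→ D
    rcvT  : ∀ {c C D} → (⌊ c ?∙ C ⌋ D) —tick→ D
    parT  : ∀ {P Q π₁ π₂} → P —tick→ π₁ → Q —tick→ π₂ → NoTau (P ∥ Q) →
            (P ∥ Q) —tick→ par π₁ π₂
    resT  : ∀ {P c π} → P —tick→ π → (P ∖ c) —tick→ mapD (λ P′ → P′ ∖ c) π
    recT  : ∀ {P π} → unfold P —tick→ π → fix P —tick→ π

  -- Cyber-physical systems E;S ▷ P (E fixed as a parameter of the relation)
  data Conf : Set where
    _▷_  : PState → Proc 0 → Conf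
    Dead : Conf

  data CLabel : Set where
    _!_  : Ch → Val → CLabel
    _¿_  : Ch → Val → CLabel
    τ    : CLabel
    tick : CLabel

  data Step (E : Env) : Conf → CLabel → Dist Conf → Set where
    outS  : ∀ {S P c v π} → inv E (ξx S) → P —[ c ! v ]→ π →
            Step E (S ▷ P) (c ! v) (mapD (S ▷_) π)
    inpS  : ∀ {S P c v π} → inv E (ξx S) → P —[ c ¿ v ]→ π →
            Step E (S ▷ P) (c ¿ v) (mapD (S ▷_) π)
    tauS  : ∀ {S P π} → inv E (ξx S) → P —[ τ ]→ π →
            Step E (S ▷ P) τ (mapD (S ▷_) π)
    readS : ∀ {S P s π} → inv E (ξx S) → P —[ rd s (num (ξs S s)) ]→ π →
            Step E (S ▷ P) τ (mapD (S ▷_) π)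
    writeS : ∀ {S P a v π} → inv E (ξx S) → P —[ wr a v ]→ π →
            Step E (S ▷ P) τ
              (mapD (⟨ ξx S , ξs S , updA (ξa S) a v ⟩ ▷_) π)
    tickS : ∀ {S P π} → inv E (ξx S) → P —tick→ π → NoTau P →
            Step E (S ▷ P) tick (bindD (next E S) (λ S′ → mapD (S′ ▷_) π))
    deadS : ∀ {S P} → ¬ inv E (ξx S) → Step E (S ▷ P) τ (dirac Dead)

  data Trace (E : Env) : Conf → Conf → Set where
    done : ∀ {M} → Trace E M M
    step : ∀ {M α γ M′ N} → Step E M α γ → supp γ M′ → Trace E M′ N → Trace E M N

data StVar : Set where temp : StVar
data Sensor : Set where sₜ : Sensor
data Actuator : Set where cool : Actuator
data Channel : Set where warning : Channel

_≟A_ : (a b : Actuator) → Dec (a ≡ b)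
cool ≟A cool = yes _≡_.refl

_≟C_ : (a b : Channel) → Dec (a ≡ b)
warning ≟C warning = yes _≡_.refl

open Calculus StVar Sensor Actuator Channel _≟A_ _≟C_ public

stepQ : ℕ → ℕ → ℚ
stepQ g h = _/_ (+ h) (10 ℕ.^ g) {{m^n≢0 10 g}}

-- [v,w]_g = { v + h·10^(-g) ∈ [v,w] : h ∈ ℕ }, enumerated for
-- h ≤ ⌈w − v⌉·10^g (a bound beyond which no point lies in [v,w]).
grid : ℚ → ℚ → ℕ → List ℚ
grid v w g =
  filter (λ k → k ≤? w)
    (map (λ h → v + stepQ g h)
         (upTo (suc (ℤ.∣ ℚ.ceiling (w + (- v)) ∣ ℕ.* (10 ℕ.^ g)))))

δ : ℚ
δ = (+ 2) / 5

err : ℚ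
err = (+ 1) / 10

isOn : Val → Bool
isOn on = true
isOn _  = false

Envg : ℕ → Env
Envg g .evol ξx ξa =
  uniform (map (λ v → λ { temp → ξx temp + v })
               (if isOn (ξa cool)
                  then grid (- 1ℚ + (- δ)) (- 1ℚ + δ) g
                  else grid (1ℚ + (- δ)) (1ℚ + δ) g))
Envg g .meas ξx =
  uniform (map (λ v → λ { sₜ → ξx temp + v }) (grid (- err) err g))
Envg g .inv ξx = (0ℚ ≤ ξx temp) × (ξx temp ≤ (+ 30) / 1)

Sg : PState
Sg = ⟨ (λ _ → 0ℚ) , (λ _ → 0ℚ) , (λ _ → off) ⟩

gt10 : Val → Bool
gt10 (num q) = does ((+ 10) / 1 <? q)
gt10 _ = false

one : {n : ℕ} → Proc n → Choice n
one P = (1ℚ , P) ∷ []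

tick^ : {n : ℕ} → ℕ → Proc n → Proc n
tick^ zero P = P
tick^ (suc k) P = tick (one (tick^ k P))

-- c!v.P  =  fix Z. ⌊c!v.P⌋Z
send : {n : ℕ} → Channel → Val → Proc n → Proc n
send c v P = fix (⌊ c ! v ∙ one (wk P) ⌋ one (var zero))

-- Inside Ctrl = fix X. …, X is var zero (scope 1).
-- Cooling = write cool⟨on⟩. fix Y. tick⁵. read sₜ(x). if x>10
--             then warning!ID.Y else write cool⟨off⟩.tick.X
Cooling : Proc 1
Cooling =
  write cool on (one (fix
    (tick^ 5 (read sₜ (λ x → one
      (if gt10 x
        then send warning ID (var zero)
        else write cool off (one (tick (one (var (suc zero)))))))))))

Ctrl : Proc 0
Ctrl = fix (read sₜ (λ x → one (if gt10 x then Cooling else tick (one (var zero)))))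

Eng : ℕ → Conf
Eng g = Sg ▷ Ctrl

-- The proof is an invariant argument over computation traces.  The
-- controller of the engine passes through finitely many control points
-- (modes): reading the sensor while idle, waiting for the next tick,
-- about to switch the cooling on, cooling with k ticks to go, about to
-- switch the cooling off.  Each mode has a closed template process and a
-- set of facts about the physical state (actuator setting, temperature
-- interval).  A configuration is good when the sensor is accurate up to
-- err and its process is extensionally equal to the template of a mode
-- whose facts hold.

module Submission where

open import Defs
open import Data.Nat using (ℕ; zero; suc; _*_; _^_; _≥_)
open import Data.Nat.Properties using (m^n≢0)
open import Data.Fin using (Fin; zero; suc)
open import Data.Integer using (+_; ∣_∣)
open import Data.Rational using (ℚ; 0ℚ; 1ℚ; _+_; -_; _<_; _≤_; _/_; ceiling)
import Data.Rational as ℚ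
open import Data.Rational.Properties
  using (_<?_; _≤?_; ≤-refl; ≤-trans; <-≤-trans; <-irrefl; ≮⇒≥; +-mono-≤; +-mono-<-≤;
         +-monoʳ-≤; +-assoc; +-identityʳ; +-0-group; nonNegative⁻¹; normalize-nonNeg)
open import Algebra.Properties.Group +-0-group using (//-rightDividesˡ; //-rightDividesʳ)
open import Data.Bool using (Bool; true; false; if_then_else_)
open import Data.List using (List; []; _∷_; _++_; map; filter; upTo)
open import Data.List.Membership.Propositional using (_∈_; find)
open import Data.List.Membership.Propositional.Properties using (∈-map⁻; ∈-filter⁻; ∈-concatMap⁻)
open import Data.List.Relation.Unary.Any using (here; there)
open import Data.Product using (Σ; _×_; _,_; proj₁; proj₂)
open import Data.Unit using (⊤; tt)
open import Data.Empty using (⊥-elim)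
open import Relation.Nullary using (Dec; yes; no; does)
open import Relation.Nullary.Decidable using (from-yes)
open import Relation.Binary.PropositionalEquality using (_≡_; refl; sym; trans; cong; subst)


mutual
  -- Structural equality, comparing the continuations of value binders
  -- pointwise: processes contain functions, so substitution rebuilds
  -- them into terms that are equal only extensionally.
  data _≅_ {n : ℕ} : Proc n → Proc n → Set where
    nil≅   : nil ≅ nil
    tick≅  : ∀ {C C′} → C ≅C C′ → tick C ≅ tick C′
    par≅   : ∀ {P P′ Q Q′} → P ≅ P′ → Q ≅ Q′ → (P ∥ Q) ≅ (P′ ∥ Q′)
    snd≅   : ∀ {c v C C′ D D′} → C ≅C C′ → D ≅C D′ → (⌊ c ! v ∙ C ⌋ D) ≅ (⌊ c ! v ∙ C′ ⌋ D′)
    rcv≅   : ∀ {c C C′ D D′} → (∀ v → C v ≅C C′ v) → D ≅C D′ → (⌊ c ?∙ C ⌋ D) ≅ (⌊ c ?∙ C′ ⌋ D′)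
    read≅  : ∀ {s C C′} → (∀ v → C v ≅C C′ v) → read s C ≅ read s C′
    write≅ : ∀ {a v C C′} → C ≅C C′ → write a v C ≅ write a v C′
    res≅   : ∀ {P P′ c} → P ≅ P′ → (P ∖ c) ≅ (P′ ∖ c)
    var≅   : ∀ {i} → var i ≅ var i
    fix≅   : ∀ {P P′} → P ≅ P′ → fix P ≅ fix P′

  data _≅C_ {n : ℕ} : Choice n → Choice n → Set where
    []  : [] ≅C []
    _∷_ : ∀ {p P P′ C C′} → P ≅ P′ → C ≅C C′ → ((p , P) ∷ C) ≅C ((p , P′) ∷ C′)

mutual
  ≅-refl : ∀ {n} (P : Proc n) → P ≅ P
  ≅-refl nil = nil≅
  ≅-refl (tick C) = tick≅ (≅C-refl C)
  ≅-refl (P ∥ Q) = par≅ (≅-refl P) (≅-refl Q)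
  ≅-refl (⌊ c ! v ∙ C ⌋ D) = snd≅ (≅C-refl C) (≅C-refl D)
  ≅-refl (⌊ c ?∙ C ⌋ D) = rcv≅ (λ v → ≅C-refl (C v)) (≅C-refl D)
  ≅-refl (read s C) = read≅ (λ v → ≅C-refl (C v))
  ≅-refl (write a v C) = write≅ (≅C-refl C)
  ≅-refl (P ∖ c) = res≅ (≅-refl P)
  ≅-refl (var i) = var≅
  ≅-refl (fix P) = fix≅ (≅-refl P)

  ≅C-refl : ∀ {n} (C : Choice n) → C ≅C C
  ≅C-refl [] = []
  ≅C-refl ((p , P) ∷ C) = ≅-refl P ∷ ≅C-refl C

mutual
  ≅-sym : ∀ {n} {P Q : Proc n} → P ≅ Q → Q ≅ P
  ≅-sym nil≅ = nil≅
  ≅-sym (tick≅ e) = tick≅ (≅C-sym e)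
  ≅-sym (par≅ e f) = par≅ (≅-sym e) (≅-sym f)
  ≅-sym (snd≅ e f) = snd≅ (≅C-sym e) (≅C-sym f)
  ≅-sym (rcv≅ e f) = rcv≅ (λ v → ≅C-sym (e v)) (≅C-sym f)
  ≅-sym (read≅ e) = read≅ (λ v → ≅C-sym (e v))
  ≅-sym (write≅ e) = write≅ (≅C-sym e)
  ≅-sym (res≅ e) = res≅ (≅-sym e)
  ≅-sym var≅ = var≅
  ≅-sym (fix≅ e) = fix≅ (≅-sym e)

  ≅C-sym : ∀ {n} {C D : Choice n} → C ≅C D → D ≅C C
  ≅C-sym [] = []
  ≅C-sym (e ∷ es) = ≅-sym e ∷ ≅C-sym es

mutual
  ≅-trans : ∀ {n} {P Q R : Proc n} → P ≅ Q → Q ≅ R → P ≅ R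
  ≅-trans nil≅ nil≅ = nil≅
  ≅-trans (tick≅ e) (tick≅ f) = tick≅ (≅C-trans e f)
  ≅-trans (par≅ e e′) (par≅ f f′) = par≅ (≅-trans e f) (≅-trans e′ f′)
  ≅-trans (snd≅ e e′) (snd≅ f f′) = snd≅ (≅C-trans e f) (≅C-trans e′ f′)
  ≅-trans (rcv≅ e e′) (rcv≅ f f′) = rcv≅ (λ v → ≅C-trans (e v) (f v)) (≅C-trans e′ f′)
  ≅-trans (read≅ e) (read≅ f) = read≅ (λ v → ≅C-trans (e v) (f v))
  ≅-trans (write≅ e) (write≅ f) = write≅ (≅C-trans e f)
  ≅-trans (res≅ e) (res≅ f) = res≅ (≅-trans e f)
  ≅-trans var≅ var≅ = var≅
  ≅-trans (fix≅ e) (fix≅ f) = fix≅ (≅-trans e f)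

  ≅C-trans : ∀ {n} {C D E : Choice n} → C ≅C D → D ≅C E → C ≅C E
  ≅C-trans [] [] = []
  ≅C-trans (e ∷ es) (f ∷ fs) = ≅-trans e f ∷ ≅C-trans es fs


mutual
  ren-cong : ∀ {n m} (ρ : Fin n → Fin m) {P Q} → P ≅ Q → ren ρ P ≅ ren ρ Q
  ren-cong ρ nil≅ = nil≅
  ren-cong ρ (tick≅ e) = tick≅ (renC-cong ρ e)
  ren-cong ρ (par≅ e f) = par≅ (ren-cong ρ e) (ren-cong ρ f)
  ren-cong ρ (snd≅ e f) = snd≅ (renC-cong ρ e) (renC-cong ρ f)
  ren-cong ρ (rcv≅ e f) = rcv≅ (λ v → renC-cong ρ (e v)) (renC-cong ρ f)
  ren-cong ρ (read≅ e) = read≅ (λ v → renC-cong ρ (e v))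
  ren-cong ρ (write≅ e) = write≅ (renC-cong ρ e)
  ren-cong ρ (res≅ e) = res≅ (ren-cong ρ e)
  ren-cong ρ var≅ = var≅
  ren-cong ρ (fix≅ e) = fix≅ (ren-cong (ext ρ) e)

  renC-cong : ∀ {n m} (ρ : Fin n → Fin m) {C D} → C ≅C D → renC ρ C ≅C renC ρ D
  renC-cong ρ [] = []
  renC-cong ρ (e ∷ es) = ren-cong ρ e ∷ renC-cong ρ es

exts-cong : ∀ {n m} {σ τ : Fin n → Proc m} → (∀ i → σ i ≅ τ i) → ∀ i → exts σ i ≅ exts τ i
exts-cong h zero = var≅
exts-cong h (suc i) = ren-cong suc (h i)

mutual
  sub-cong : ∀ {n m} {σ τ : Fin n → Proc m} → (∀ i → σ i ≅ τ i) →
             ∀ {P Q} → P ≅ Q → sub σ P ≅ sub τ Q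
  sub-cong h nil≅ = nil≅
  sub-cong h (tick≅ e) = tick≅ (subC-cong h e)
  sub-cong h (par≅ e f) = par≅ (sub-cong h e) (sub-cong h f)
  sub-cong h (snd≅ e f) = snd≅ (subC-cong h e) (subC-cong h f)
  sub-cong h (rcv≅ e f) = rcv≅ (λ v → subC-cong h (e v)) (subC-cong h f)
  sub-cong h (read≅ e) = read≅ (λ v → subC-cong h (e v))
  sub-cong h (write≅ e) = write≅ (subC-cong h e)
  sub-cong h (res≅ e) = res≅ (sub-cong h e)
  sub-cong h (var≅ {i}) = h i
  sub-cong h (fix≅ e) = fix≅ (sub-cong (exts-cong h) e)

  subC-cong : ∀ {n m} {σ τ : Fin n → Proc m} → (∀ i → σ i ≅ τ i) →
              ∀ {C D} → C ≅C D → subC σ C ≅C subC τ D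
  subC-cong h [] = []
  subC-cong h (e ∷ es) = sub-cong h e ∷ subC-cong h es

unfold-cong : ∀ {P Q : Proc 1} → P ≅ Q → unfold P ≅ unfold Q
unfold-cong e = sub-cong (λ { zero → fix≅ e }) e

unfold-sub : ∀ (P : Proc 1) {τ : Fin 1 → Proc 0} → fix P ≅ τ zero → unfold P ≅ sub τ P
unfold-sub P h = sub-cong (λ { zero → h }) (≅-refl P)

mutual
  sub-ren-inverse : ∀ {n m} {σ : Fin m → Proc n} {ρ : Fin n → Fin m} →
                    (∀ i → σ (ρ i) ≅ var i) → ∀ P → sub σ (ren ρ P) ≅ P
  sub-ren-inverse h nil = nil≅
  sub-ren-inverse h (tick C) = tick≅ (subC-ren-inverse h C)
  sub-ren-inverse h (P ∥ Q) = par≅ (sub-ren-inverse h P) (sub-ren-inverse h Q)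
  sub-ren-inverse h (⌊ c ! v ∙ C ⌋ D) = snd≅ (subC-ren-inverse h C) (subC-ren-inverse h D)
  sub-ren-inverse h (⌊ c ?∙ C ⌋ D) = rcv≅ (λ v → subC-ren-inverse h (C v)) (subC-ren-inverse h D)
  sub-ren-inverse h (read s C) = read≅ (λ v → subC-ren-inverse h (C v))
  sub-ren-inverse h (write a v C) = write≅ (subC-ren-inverse h C)
  sub-ren-inverse h (P ∖ c) = res≅ (sub-ren-inverse h P)
  sub-ren-inverse h (var i) = h i
  sub-ren-inverse {σ = σ} {ρ} h (fix P) = fix≅ (sub-ren-inverse exts-inverse P)
    where
      exts-inverse : ∀ i → exts σ (ext ρ i) ≅ var i
      exts-inverse zero = var≅
      exts-inverse (suc i) = ren-cong suc (h i)

  subC-ren-inverse : ∀ {n m} {σ : Fin m → Proc n} {ρ : Fin n → Fin m} →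
                     (∀ i → σ (ρ i) ≅ var i) → ∀ C → subC σ (renC ρ C) ≅C C
  subC-ren-inverse h [] = []
  subC-ren-inverse h ((p , P) ∷ C) = sub-ren-inverse h P ∷ subC-ren-inverse h C


++-cong : ∀ {C C′ D D′ : Dist (Proc 0)} → C ≅C C′ → D ≅C D′ → (C ++ D) ≅C (C′ ++ D′)
++-cong [] f = f
++-cong (e ∷ es) f = e ∷ ++-cong es f

mapD-cong : ∀ {f g : Proc 0 → Proc 0} → (∀ {P Q} → P ≅ Q → f P ≅ g Q) →
            ∀ {π π′} → π ≅C π′ → mapD f π ≅C mapD g π′
mapD-cong h [] = []
mapD-cong h (e ∷ es) = h e ∷ mapD-cong h es

bindD-cong : ∀ {f g : Proc 0 → Dist (Proc 0)} → (∀ {P Q} → P ≅ Q → f P ≅C g Q) →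
             ∀ {π π′} → π ≅C π′ → bindD π f ≅C bindD π′ g
bindD-cong h [] = []
bindD-cong h (_∷_ {p} e es) = ++-cong (weighted (h e)) (bindD-cong h es)
  where
    weighted : ∀ {C C′} → C ≅C C′ →
               map (λ { (q , b) → (p ℚ.* q , b) }) C ≅C map (λ { (q , b) → (p ℚ.* q , b) }) C′
    weighted [] = []
    weighted (e ∷ es) = e ∷ weighted es

par-cong : ∀ {π₁ π₁′ π₂ π₂′} → π₁ ≅C π₁′ → π₂ ≅C π₂′ → par π₁ π₂ ≅C par π₁′ π₂′
par-cong e₁ e₂ = bindD-cong (λ e → mapD-cong (par≅ e) e₂) e₁

∈-transfer : ∀ {π π′ : Dist (Proc 0)} {p P} → π ≅C π′ → (p , P) ∈ π →
             Σ (Proc 0) λ P′ → ((p , P′) ∈ π′) × (P ≅ P′)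
∈-transfer (e ∷ es) (here refl) = _ , here refl , e
∈-transfer (e ∷ es) (there m) with ∈-transfer es m
... | P′ , m′ , e′ = P′ , there m′ , e′


transfer : ∀ {P Q α π} → P ≅ Q → P —[ α ]→ π →
           Σ (Dist (Proc 0)) λ π′ → (Q —[ α ]→ π′) × (π ≅C π′)
transfer (snd≅ e _) snd = _ , snd , e
transfer (rcv≅ e _) (rcv v) = _ , rcv v , e v
transfer (write≅ e) write′ = _ , write′ , e
transfer (read≅ e) (read′ v) = _ , read′ v , e v
transfer (par≅ e f) (syncˡ t u) with transfer e t | transfer f u
... | _ , t′ , e′ | _ , u′ , f′ = _ , syncˡ t′ u′ , par-cong e′ f′
transfer (par≅ e f) (syncʳ t u) with transfer e t | transfer f u
... | _ , t′ , e′ | _ , u′ , f′ = _ , syncʳ t′ u′ , par-cong e′ f′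
transfer (par≅ e f) (parˡ t) with transfer e t
... | _ , t′ , e′ = _ , parˡ t′ , mapD-cong (λ x → par≅ x f) e′
transfer (par≅ e f) (parʳ t) with transfer f t
... | _ , t′ , f′ = _ , parʳ t′ , mapD-cong (par≅ e) f′
transfer (res≅ e) (res n t) with transfer e t
... | _ , t′ , e′ = _ , res n t′ , mapD-cong res≅ e′
transfer (fix≅ e) (rec t) with transfer (unfold-cong e) t
... | _ , t′ , e′ = _ , rec t′ , e′

noTau-cong : ∀ {P Q} → P ≅ Q → NoTau P → NoTau Q
noTau-cong e noτ (_ , t) = noτ (_ , proj₁ (proj₂ (transfer (≅-sym e) t)))

transferT : ∀ {P Q π} → P ≅ Q → P —tick→ π →
            Σ (Dist (Proc 0)) λ π′ → (Q —tick→ π′) × (π ≅C π′)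
transferT nil≅ nilT = _ , nilT , (nil≅ ∷ [])
transferT (tick≅ e) tickT = _ , tickT , e
transferT (snd≅ _ e) sndT = _ , sndT , e
transferT (rcv≅ _ e) rcvT = _ , rcvT , e
transferT (par≅ e f) (parT t u noτ) with transferT e t | transferT f u
... | _ , t′ , e′ | _ , u′ , f′ = _ , parT t′ u′ (noTau-cong (par≅ e f) noτ) , par-cong e′ f′
transferT (res≅ e) (resT t) with transferT e t
... | _ , t′ , e′ = _ , resT t′ , mapD-cong res≅ e′
transferT (fix≅ e) (recT t) with transferT (unfold-cong e) t
... | _ , t′ , e′ = _ , recT t′ , e′


∈-mapD : ∀ {A B : Set} {f : A → B} {d : Dist A} {p b} → (p , b) ∈ mapD f d →
         Σ A λ a → ((p , a) ∈ d) × (b ≡ f a)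
∈-mapD m with ∈-map⁻ _ m
... | (_ , a) , m′ , refl = a , m′ , refl

∈-bindD : ∀ {A B : Set} {d : Dist A} {f : A → Dist B} {p b} → (p , b) ∈ bindD d f →
          Σ A λ a → (Σ ℚ λ q → (q , a) ∈ d) × (Σ ℚ λ r → (r , b) ∈ f a)
∈-bindD {d = d} m with find (∈-concatMap⁻ _ {xs = d} m)
... | (q , a) , m₁ , m₂ with ∈-map⁻ _ m₂
... | (r , _) , m₃ , refl = a , (q , m₁) , (r , m₃)

∈-uniform : ∀ {A : Set} {xs : List A} {p a} → (p , a) ∈ uniform xs → a ∈ xs
∈-uniform {xs = x ∷ xs} m with ∈-map⁻ _ m
... | _ , m′ , refl = m′

∈-uniform-image : ∀ {A B C : Set} (xs : List A) (f : A → B) (h : B → C) (k : A → C) →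
                  (∀ a → h (f a) ≡ k a) → ∀ {p b} → (p , b) ∈ uniform (map f xs) →
                  Σ A λ a → (a ∈ xs) × (h b ≡ k a)
∈-uniform-image xs f h k hf≡k m with ∈-map⁻ f (∈-uniform m)
... | a , m-a , refl = a , m-a , hf≡k a

∈-grid-offsets : ∀ {a b g v} (hs : List ℕ) →
                 v ∈ filter (λ k → k ≤? b) (map (λ h → a + stepQ g h) hs) → (a ≤ v) × (v ≤ b)
∈-grid-offsets {a} {b} {g} hs m with ∈-filter⁻ (λ k → k ≤? b) {xs = map (λ h → a + stepQ g h) hs} m
... | m′ , v≤b with ∈-map⁻ (λ h → a + stepQ g h) m′
... | h , _ , refl = subst (_≤ a + stepQ g h) (+-identityʳ a) (+-monoʳ-≤ a step≥0) , v≤b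
  where
    step≥0 : 0ℚ ≤ stepQ g h
    step≥0 = nonNegative⁻¹ (stepQ g h) {{normalize-nonNeg h (10 ^ g) {{m^n≢0 10 g}}}}

∈-grid : ∀ {a b g v} → v ∈ grid a b g → (a ≤ v) × (v ≤ b)
∈-grid {a} {b} {g} = ∈-grid-offsets {g = g} (upTo (suc (∣ ceiling (b + (- a)) ∣ * 10 ^ g)))


driftLo driftHi : Bool → ℚ
driftLo true  = - 1ℚ + (- δ)
driftLo false = 1ℚ + (- δ)
driftHi true  = - 1ℚ + δ
driftHi false = 1ℚ + δ

driftGrid : Bool → ℕ → List ℚ
driftGrid c g = if c then grid (- 1ℚ + (- δ)) (- 1ℚ + δ) g else grid (1ℚ + (- δ)) (1ℚ + δ) g

∈-drift : ∀ c g {v} → v ∈ driftGrid c g →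
          (driftLo c ≤ v) × (v ≤ driftHi c)
∈-drift true g m = ∈-grid {g = g} m
∈-drift false g m = ∈-grid {g = g} m

SensorAccurate : PState → Set
SensorAccurate S = Σ ℚ λ w → (- err ≤ w) × (w ≤ err) × (ξs S sₜ ≡ ξx S temp + w)

record TickOutcome (S S′ : PState) : Set where
  field
    change    : ℚ
    temp-next : ξx S′ temp ≡ ξx S temp + change
    slowest   : driftLo (isOn (ξa S cool)) ≤ change
    fastest   : change ≤ driftHi (isOn (ξa S cool))
    actuators : ξa S′ ≡ ξa S
    sensor    : SensorAccurate S′

evol-outcome : ∀ g ξ α {q x′} → (q , x′) ∈ evol (Envg g) ξ α →
               Σ ℚ λ v → ((driftLo (isOn (α cool)) ≤ v) × (v ≤ driftHi (isOn (α cool)))) ×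
                         (x′ temp ≡ ξ temp + v)
evol-outcome g ξ α m =
  let v , m-v , x′≡ = ∈-uniform-image (driftGrid (isOn (α cool)) g) _ (λ x → x temp)
                                      (λ v → ξ temp + v) (λ _ → refl) m
  in v , ∈-drift (isOn (α cool)) g m-v , x′≡

meas-outcome : ∀ g ξ {q s′} → (q , s′) ∈ meas (Envg g) ξ →
               Σ ℚ λ w → (- err ≤ w) × (w ≤ err) × (s′ sₜ ≡ ξ temp + w)
meas-outcome g ξ m =
  let w , m-w , s′≡ = ∈-uniform-image (grid (- err) err g) _ (λ s → s sₜ)
                                      (λ w → ξ temp + w) (λ _ → refl) m
      -err≤w , w≤err = ∈-grid {g = g} m-w
  in w , -err≤w , w≤err , s′≡

drawn-outcome : ∀ {g S x′ s′ q r} → (q , x′) ∈ evol (Envg g) (ξx S) (ξa S) →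
                (r , s′) ∈ meas (Envg g) x′ → TickOutcome S ⟨ x′ , s′ , ξa S ⟩
drawn-outcome {g} {S} {x′} m-evol m-meas =
  let v , (slowest , fastest) , temp-next = evol-outcome g (ξx S) (ξa S) m-evol
  in record { change = v ; temp-next = temp-next ; slowest = slowest ; fastest = fastest
            ; actuators = refl ; sensor = meas-outcome g x′ m-meas }

tick-outcome : ∀ {g S S′ q} → (q , S′) ∈ next (Envg g) S → TickOutcome S S′
tick-outcome {g} {S} m =
  let x′ , (_ , m-evol) , (_ , m-meas) =
        ∈-bindD {d = evol (Envg g) (ξx S) (ξa S)}
                {f = λ x′ → mapD (λ s′ → ⟨ x′ , s′ , ξa S ⟩) (meas (Envg g) x′)} m
      _ , m-sensor , S′≡ = ∈-mapD {f = λ s′ → ⟨ x′ , s′ , ξa S ⟩} m-meas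
  in subst (TickOutcome S) (sym S′≡) (drawn-outcome {g} m-evol m-sensor)

actuator-kept : ∀ {S S′ a} → TickOutcome S S′ → ξa S cool ≡ a → ξa S′ cool ≡ a
actuator-kept o = trans (cong (λ ξ → ξ cool) (TickOutcome.actuators o))

drift-when : ∀ {S S′ a} → (o : TickOutcome S S′) → ξa S cool ≡ a →
             (driftLo (isOn a) ≤ TickOutcome.change o) × (TickOutcome.change o ≤ driftHi (isOn a))
drift-when o eq = subst (λ a → driftLo (isOn a) ≤ _) eq (TickOutcome.slowest o)
                , subst (λ a → _ ≤ driftHi (isOn a)) eq (TickOutcome.fastest o)


_∈⟨_,_] : ℚ → ℚ → ℚ → Set
t ∈⟨ a , b ] = (a < t) × (t ≤ b)

shift-interval : ∀ {a b c d t v} → t ∈⟨ a , b ] → c ≤ v → v ≤ d → (t + v) ∈⟨ a + c , b + d ]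
shift-interval (a<t , t≤b) c≤v v≤d = +-mono-<-≤ a<t c≤v , +-mono-≤ t≤b v≤d

module _ {e s t w x : ℚ} (s≡t+w : s ≡ t + w) where

  reading-above : w ≤ e → x < s → x + (- e) < t
  reading-above w≤e x<s = subst (x + (- e) <_) (//-rightDividesʳ e t)
    (+-mono-<-≤ (<-≤-trans x<s (subst (_≤ t + e) (sym s≡t+w) (+-monoʳ-≤ t w≤e))) (≤-refl { - e}))

  reading-below : - e ≤ w → s ≤ x → t ≤ x + e
  reading-below -e≤w s≤x = subst (_≤ x + e) (//-rightDividesˡ e t)
    (+-mono-≤ (≤-trans (subst (t + (- e) ≤_) (sym s≡t+w) (+-monoʳ-≤ t -e≤w)) s≤x) (≤-refl {e}))

  reading-bound : w ≤ e → t ≤ x → s ≤ x + e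
  reading-bound w≤e t≤x = subst (_≤ x + e) (sym s≡t+w) (+-mono-≤ t≤x w≤e)

data Above10 (q : ℚ) : Bool → Set where
  above : (+ 10) / 1 < q → Above10 q true
  below : q ≤ (+ 10) / 1 → Above10 q false

above10? : ∀ q → Above10 q (gt10 (num q))
above10? q = view ((+ 10) / 1 <? q)
  where
    view : (d : Dec ((+ 10) / 1 < q)) → Above10 q (does d)
    view (yes p) = above p
    view (no ¬p) = below (≮⇒≥ ¬p)


-- The reading and decision at the end of the loop fix Y. tick⁵. … of Cooling.
coolCheck : Proc 2
coolCheck = read sₜ (λ x → one (if gt10 x then send warning ID (var zero)
                                 else write cool off (one (tick (one (var (suc zero)))))))

ctrlσ : Fin 1 → Proc 0
ctrlσ _ = Ctrl

-- The process running once the cooling has been switched on.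
CoolingLoop : Proc 0
CoolingLoop = fix (sub (exts ctrlσ) (tick^ 5 coolCheck))

loopσ : Fin 1 → Proc 0
loopσ _ = CoolingLoop

Countdown : ℕ → Proc 0
Countdown k = sub loopσ (sub (exts ctrlσ) (tick^ k coolCheck))

loop-unfolds : unfold (sub (exts ctrlσ) (tick^ 5 coolCheck)) ≅ Countdown 5
loop-unfolds = unfold-sub _ (≅-refl CoolingLoop)

data Mode : Set where
  idle waiting switchingOn coolingStart switchingOff : Mode
  cooling : ℕ → Mode

template : Mode → Proc 0
template idle         = Ctrl
template waiting      = tick (one Ctrl)
template switchingOn  = write cool on (one CoolingLoop)
template coolingStart = CoolingLoop
template (cooling k)  = Countdown k
template switchingOff = write cool off (one (tick (one Ctrl)))

SwitchWindow : Val → ℚ → Set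
SwitchWindow on  t = t ∈⟨ (+ 99) / 10 , (+ 23) / 2 ]
SwitchWindow off t = t ∈⟨ (+ 29) / 10 , (+ 17) / 2 ]
SwitchWindow _   _ = ⊤

-- With k ticks of cooling to go the temperature lies in (coolLo k, coolHi k];
-- each tick of cooling lowers the bounds by the extreme drifts.
coolLo coolHi : ℕ → ℚ
coolLo zero    = (+ 29) / 10
coolLo (suc k) = coolLo k + (+ 7) / 5
coolHi zero    = (+ 17) / 2
coolHi (suc k) = coolHi k + (+ 3) / 5

CoolingFacts : ℕ → PState → Set
CoolingFacts k S = (ξa S cool ≡ on) × (ξx S temp ∈⟨ coolLo k , coolHi k ])

Facts : Mode → PState → Set
Facts idle         S = (ξa S cool ≡ off) × (ξx S temp ≤ (+ 23) / 2)
Facts waiting      S = (ξa S cool ≡ off) × (ξx S temp ≤ (+ 101) / 10)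
Facts switchingOn  S = SwitchWindow on (ξx S temp)
Facts coolingStart S = CoolingFacts 5 S
Facts (cooling k)  S = CoolingFacts k S
Facts switchingOff S = SwitchWindow off (ξx S temp)

interval-≡ : ∀ {t t′ a a′ b b′} → t ≡ t′ → a ≡ a′ → b ≡ b′ → t ∈⟨ a , b ] → t′ ∈⟨ a′ , b′ ]
interval-≡ refl refl refl i = i

+-cancelling : ∀ {x d e} → d + e ≡ 0ℚ → (x + d) + e ≡ x
+-cancelling {x} {d} {e} d+e≡0 = trans (+-assoc x d e) (trans (cong (λ y → x + y) d+e≡0) (+-identityʳ x))

cooling-tick : ∀ {k S S′} → CoolingFacts (suc k) S → TickOutcome S S′ → CoolingFacts k S′
cooling-tick (on≡ , window) o =
  actuator-kept o on≡ ,
  interval-≡ (sym (TickOutcome.temp-next o)) (+-cancelling refl) (+-cancelling refl)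
             (shift-interval window (proj₁ drift) (proj₂ drift))
  where drift = drift-when o on≡

actuate : (Actuator → Val) → Label → (Actuator → Val)
actuate ξ (wr a v) = updA ξ a v
actuate ξ _        = ξ

after : PState → Label → PState
after S β = ⟨ ξx S , ξs S , actuate (ξa S) β ⟩

Admissible : PState → Label → Set
Admissible S (rd s v) = v ≡ num (ξs S s)
Admissible S _        = ⊤

Reaches : PState → Dist (Proc 0) → Set
Reaches S π = ∀ {q T} → (q , T) ∈ π → Σ Mode λ m → (T ≅ template m) × Facts m S

reaches-transfer : ∀ {S π π′} → π ≅C π′ → Reaches S π′ → Reaches S π
reaches-transfer e reaches m =
  let T , m-T , P≅T = ∈-transfer e m
      mode , T≅ , facts = reaches m-T
  in mode , ≅-trans P≅T T≅ , facts

reaches-one : ∀ {S T} → (Σ Mode λ m → (T ≅ template m) × Facts m S) → Reaches S ((1ℚ , T) ∷ [])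
reaches-one r (here refl) = r

ctrl-reads : ∀ {S} {σ : Fin 1 → Proc 0} → σ zero ≅ Ctrl → SensorAccurate S → Facts idle S →
             Σ Mode λ m → (sub σ (if gt10 (num (ξs S sₜ)) then Cooling else tick (one (var zero)))
                            ≅ template m) × Facts m S
ctrl-reads {S} σ≅ (w , -err≤w , w≤err , s≡) (off≡ , t≤) with gt10 (num (ξs S sₜ)) | above10? (ξs S sₜ)
... | true  | above hot = switchingOn , sub-cong (λ { zero → σ≅ }) (≅-refl Cooling) ,
                          reading-above {e = err} {x = (+ 10) / 1} s≡ w≤err hot , t≤
... | false | below cold = waiting , tick≅ (σ≅ ∷ []) , off≡ , reading-below {e = err} {x = (+ 10) / 1} s≡ -err≤w cold

-- The cooling loop after its reading: the temperature is at most 8.5, so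
-- the reading is at most 10 and the loop switches the cooling off.
check-reads : ∀ {S} → SensorAccurate S → CoolingFacts 0 S →
              Σ Mode λ m → (sub loopσ (sub (exts ctrlσ)
                             (if gt10 (num (ξs S sₜ)) then send warning ID (var zero)
                              else write cool off (one (tick (one (var (suc zero))))))) ≅ template m)
                         × Facts m S
check-reads {S} (w , _ , w≤err , s≡) (_ , window) with gt10 (num (ξs S sₜ)) | above10? (ξs S sₜ)
... | true  | above hot = ⊥-elim (<-irrefl refl (<-≤-trans hot reading≤10))
  where
    reading≤10 : ξs S sₜ ≤ (+ 10) / 1
    reading≤10 = ≤-trans (reading-bound {e = err} {x = (+ 17) / 2} s≡ w≤err (proj₂ window))
                         (from-yes ((+ 17) / 2 + err ≤? (+ 10) / 1))
... | false | below _ = switchingOff , write≅ (tick≅ (sub-ren-inverse (λ ()) Ctrl ∷ []) ∷ []) , window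

template-move : ∀ m {S β π} → SensorAccurate S → Facts m S → template m —[ β ]→ π →
                Admissible S β → Reaches (after S β) π
template-move idle acc f (rec (read′ _)) refl = reaches-one (ctrl-reads (≅-refl Ctrl) acc f)
template-move switchingOn _ f write′ _ = reaches-one (coolingStart , ≅-refl CoolingLoop , refl , f)
template-move (cooling zero) acc f (read′ _) refl = reaches-one (check-reads acc f)
template-move switchingOff _ f write′ _ =
  reaches-one (waiting , ≅-refl (tick (one Ctrl)) , refl ,
               ≤-trans (proj₂ f) (from-yes ((+ 17) / 2 ≤? (+ 101) / 10)))
template-move waiting _ _ ()
template-move coolingStart _ _ (rec ())
template-move (cooling (suc k)) _ _ ()

countdown-tick : ∀ {k S S′ π} → CoolingFacts (suc k) S → TickOutcome S S′ →
                 Countdown (suc k) —tick→ π → Reaches S′ π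
countdown-tick {k} f o tickT = reaches-one (cooling k , ≅-refl (Countdown k) , cooling-tick {k} f o)

template-tick : ∀ m {S S′ π} → Facts m S → TickOutcome S S′ → template m —tick→ π → Reaches S′ π
template-tick waiting (off≡ , t≤) o tickT =
  reaches-one (idle , ≅-refl Ctrl , actuator-kept o off≡ ,
               subst (_≤ (+ 23) / 2) (sym (TickOutcome.temp-next o))
                     (+-mono-≤ t≤ (proj₂ (drift-when o off≡))))
template-tick coolingStart f o (recT t) =
  let _ , t′ , e = transferT loop-unfolds t in reaches-transfer e (countdown-tick {4} f o t′)
template-tick (cooling (suc k)) f o t = countdown-tick {k} f o t
template-tick idle _ _ (recT ())
template-tick switchingOn _ _ ()
template-tick (cooling zero) _ _ ()
template-tick switchingOff _ _ ()

switch-window : ∀ m {S a v π} → Facts m S → template m —[ wr a v ]→ π → SwitchWindow v (ξx S temp)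
switch-window switchingOn f write′ = f
switch-window switchingOff f write′ = f
switch-window idle _ (rec ())
switch-window waiting _ ()
switch-window coolingStart _ (rec ())
switch-window (cooling zero) _ ()
switch-window (cooling (suc k)) _ ()


record Good (S : PState) (P : Proc 0) : Set where
  field
    accurate : SensorAccurate S
    mode     : Mode
    behaves  : P ≅ template mode
    facts    : Facts mode S
open Good

GoodConf : Conf → Set
GoodConf (S ▷ P) = Good S P
GoodConf Dead    = ⊤

initially-good : ∀ g → GoodConf (Eng g)
initially-good g = record
  { accurate = 0ℚ , from-yes (- err ≤? 0ℚ) , from-yes (0ℚ ≤? err) , refl
  ; mode = idle ; behaves = ≅-refl Ctrl ; facts = refl , from-yes (0ℚ ≤? (+ 23) / 2) }

successors-good : ∀ {S π π′ q M} → SensorAccurate S → π ≅C π′ → Reaches S π′ →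
                  (q , M) ∈ mapD (S ▷_) π → GoodConf M
successors-good acc e reaches m with ∈-mapD m
... | P , m-P , refl =
  let mode , P≅ , facts = reaches-transfer e reaches m-P
  in record { accurate = acc ; mode = mode ; behaves = P≅ ; facts = facts }

module _ (g : ℕ) where

  move-good : ∀ {S P β π q M} → Good S P → P —[ β ]→ π → Admissible S β →
              (q , M) ∈ mapD (after S β ▷_) π → GoodConf M
  move-good G t adm m =
    let _ , t′ , e = transfer (behaves G) t
    in successors-good (accurate G) e (template-move (mode G) (accurate G) (facts G) t′ adm) m

  tick-good : ∀ {S P π q M} → Good S P → P —tick→ π →
              (q , M) ∈ bindD (next (Envg g) S) (λ S′ → mapD (S′ ▷_) π) → GoodConf M
  tick-good {S} {π = π} G t m =
    let _ , t′ , e = transferT (behaves G) t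
        _ , (_ , m-next) , (_ , m′) = ∈-bindD {d = next (Envg g) S} {f = λ S′ → mapD (S′ ▷_) π} m
        o = tick-outcome {g} m-next
    in successors-good (TickOutcome.sensor o) e (template-tick (mode G) (facts G) o t′) m′

  step-good : ∀ {M α γ M′} → Step (Envg g) M α γ → supp γ M′ → GoodConf M → GoodConf M′
  step-good (outS _ t)    (_ , m , _) G = move-good G t tt m
  step-good (inpS _ t)    (_ , m , _) G = move-good G t tt m
  step-good (tauS _ t)    (_ , m , _) G = move-good G t tt m
  step-good (readS _ t)   (_ , m , _) G = move-good G t refl m
  step-good (writeS _ t)  (_ , m , _) G = move-good G t tt m
  step-good (tickS _ t _) (_ , m , _) G = tick-good G t m
  step-good (deadS _) (_ , here refl , _) _ = tt

  reachable-good : ∀ {M N} → Trace (Envg g) M N → GoodConf M → GoodConf N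
  reachable-good done G = G
  reachable-good (step s m trace) G = reachable-good trace (step-good s m G)


proposition2 : ∀ (g : ℕ) → g ≥ 1 →
    ∀ (S : PState) (P : Proc 0) → Trace (Envg g) (Eng g) (S ▷ P) →
    inv (Envg g) (ξx S) →
    (∀ π → P —[ wr cool on ]→ π → ((+ 99) / 10 < ξx S temp) × (ξx S temp ≤ (+ 23) / 2)) ×
    (∀ π → P —[ wr cool off ]→ π → ((+ 29) / 10 < ξx S temp) × (ξx S temp ≤ (+ 17) / 2))
proposition2 g _ S P trace _ = (λ _ → window) , (λ _ → window)
  where
    good : Good S P
    good = reachable-good g trace (initially-good g)

    window : ∀ {v π} → P —[ wr cool v ]→ π → SwitchWindow v (ξx S temp)
    window t = switch-window (mode good) (facts good) (proj₁ (proj₂ (transfer (behaves good) t)))
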